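{- Among all graphs $G$ of order $n$ and degeneracy $k$ with $k=o(\sqrt{n})$, the maximum possible value of $\mathrm{Mo}^{*}(G)$ is $\frac{1}{2}n^3(1-o(1))$.
   Context: For a graph $G$ and distinct vertices $u,v$, let $n_G(u,v)$ be the number of vertices strictly closer to $u$ than to $v$. The total Mostar index is $\mathrm{Mo}^{*}(G)=\sum_{\{u,v\}\subset V(G),\,u\neq v}|n_G(u,v)-n_G(v,u)|$, the sum over all unordered pairs of distinct vertices. The degeneracy of $G$ is the least $k$ such that every subgraph of $G$ has a vertex of degree at most $k$. -}

module Defs where

open import Data.Nat using (ℕ; zero; suc; _+_; _*_; _≤_; _<_; _<ᵇ_; ∣_-_∣)
open import Data.Bool using (Bool; true; false; _∧_; _∨_; if_then_else_)
open import Data.Fin using (Fin; toℕ; _≟_)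
open import Data.List using (List; allFin; filterᵇ; length; map; concatMap)
open import Data.Nat.ListAction using (sum)
open import Data.Bool.ListAction using (any)
open import Data.Product using (Σ; _×_; ∃)
open import Relation.Nullary using (¬_; does)
open import Relation.Binary.PropositionalEquality using (_≡_)

record Graph (n : ℕ) : Set where
  field
    adj    : Fin n → Fin n → Bool
    sym    : ∀ u v → adj u v ≡ adj v u
    irrefl : ∀ v → adj v v ≡ false
open Graph public

vertices : (n : ℕ) → List (Fin n)
vertices n = allFin n

reach : {n : ℕ} → Graph n → Fin n → Fin n → ℕ → Bool
reach {n} G u v zero    = does (u ≟ v)
reach {n} G u v (suc d) =
  reach G u v d ∨ any (λ w → adj G w v ∧ reach G u w d) (vertices n)

search : {n : ℕ} → Graph n → Fin n → Fin n → ℕ → ℕ → ℕ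
search G u v d zero       = d
search G u v d (suc fuel) = if reach G u v d then d else search G u v (suc d) fuel

-- Graph distance.  Finite distances are < n; the value n plays the role
-- of ∞ (u, v in different components).
dist : {n : ℕ} → Graph n → Fin n → Fin n → ℕ
dist {n} G u v = search G u v 0 n

nG : {n : ℕ} → Graph n → Fin n → Fin n → ℕ
nG {n} G u v = length (filterᵇ (λ w → dist G w u <ᵇ dist G w v) (vertices n))

totalMostar : {n : ℕ} → Graph n → ℕ
totalMostar {n} G =
  sum (concatMap (λ u → map (λ v → ∣ nG G u v - nG G v u ∣)
                     (filterᵇ (λ v → toℕ u <ᵇ toℕ v) (vertices n)))
        (vertices n))

record Subgraph {n : ℕ} (G : Graph n) : Set where
  field
    S     : Fin n → Bool
    H     : Fin n → Fin n → Bool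
    Hsym  : ∀ u v → H u v ≡ H v u
    H⊆G   : ∀ u v → H u v ≡ true → adj G u v ≡ true
    H⊆S   : ∀ u v → H u v ≡ true → S u ≡ true × S v ≡ true
open Subgraph public

degIn : {n : ℕ} {G : Graph n} → Subgraph G → Fin n → ℕ
degIn {n} K v = length (filterᵇ (λ w → H K v w) (vertices n))

EverySubgraphHasLowDeg : {n : ℕ} → Graph n → ℕ → Set
EverySubgraphHasLowDeg G k =
  (K : Subgraph G) → (∃ λ v → S K v ≡ true) →
  ∃ λ v → S K v ≡ true × degIn K v ≤ k

HasDegeneracy : {n : ℕ} → Graph n → ℕ → Set
HasDegeneracy G k =
  EverySubgraphHasLowDeg G k × (∀ j → j < k → ¬ EverySubgraphHasLowDeg G j)

module Submission where

-- Upper bound: each of the n(n − 1)/2 terms |n(u,v) − n(v,u)| is at most n.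
-- Lower bound: take a spider with ℓ = 12m + 1 legs of length L ≈ n / ℓ joined at a hub, together with
-- a clique K_{k+1} (the spider is a tree, so the degeneracy is k) and isolated vertices. If u is nearer
-- to the hub than v, every spider vertex off the leg of v is strictly closer to u, going through the hub,
-- while only vertices of the leg of v can be closer to v; so the pair contributes at least M + 1 − 2L,
-- where M = Lℓ. Summing over the pairs on different levels gives 2 Mo* ≥ n³ (1 − O(1/m)).
-- Distances are bounded from below by 1-Lipschitz potentials.

open import Algebra.Properties.CommutativeSemigroup using (x∙yz≈y∙xz)
open import Data.Bool using (Bool; true; false; if_then_else_; T)
open import Data.Bool.Properties using (T-≡; T-∨; T-∧)
open import Data.Fin as Fin using (Fin; toℕ; fromℕ<)
open import Data.Fin.Properties using (toℕ<n; toℕ-fromℕ<; toℕ-injective)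
open import Data.List using (List; []; _∷_; length; map; filter; concatMap; allFin; tabulate)
open import Data.List.Extrema.Nat using (argmax; argmax-sel; f[xs]≤f[argmax])
open import Data.List.Membership.Propositional using (lose)
open import Data.List.Membership.Propositional.Properties using (∈-allFin; ∈-filter⁺; ∈-filter⁻)
open import Data.List.Properties using (map-tabulate; length-filter; length-tabulate)
open import Data.List.Relation.Binary.Sublist.Propositional using (⊆-refl)
open import Data.List.Relation.Binary.Sublist.Propositional.Properties using (filter⁺; length-mono-≤)
import Data.List.Relation.Unary.All as All
open import Data.List.Relation.Unary.Any using (satisfied)
open import Data.List.Relation.Unary.Any.Properties using (any⁺; any⁻)
open import Data.Nat using (ℕ; zero; suc; pred; _+_; _*_; _^_; _∸_; _⊔_; _/_; _%_; _≤_; _<_; _<ᵇ_; ∣_-_∣;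
                            z≤n; s≤s; z<s; _≟_; _<?_; _≤?_; NonZero; >-nonZero⁻¹)
open import Data.Nat.DivMod
open import Data.Nat.ListAction using (sum)
open import Data.Nat.ListAction.Properties using (sum-++)
open import Data.Nat.Properties
open import Data.Nat.Tactic.RingSolver using (solve-∀)
open import Data.Product using (Σ; _×_; ∃; _,_; proj₁; proj₂)
open import Data.Sum using (_⊎_; inj₁; inj₂)
open import Function using (id; _∘_; _⇔_; mk⇔; Equivalence)
open import Level using (0ℓ)
open import Relation.Binary.PropositionalEquality
open import Relation.Nullary using (¬_; Dec; yes; no; does; contradiction; _×-dec_; _⊎-dec_; ¬?; T?; map′)
open import Relation.Nullary.Decidable using (dec-true; dec-false; does-⇔)
open import Relation.Unary using (Pred; Decidable)

open import Defs hiding (sym)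

does⇒ : {A : Set} (a? : Dec A) → T (does a?) → A
does⇒ (yes a) _ = a

⇒does : {A : Set} (a? : Dec A) → A → T (does a?)
⇒does a? a = Equivalence.from T-≡ (dec-true a? a)

indicator : {A : Set} → Dec A → ℕ
indicator a? = if does a? then 1 else 0

indicator-mono : {A B : Set} → (A → B) → (a? : Dec A) (b? : Dec B) → indicator a? ≤ indicator b?
indicator-mono A⇒B (no _)  _       = z≤n
indicator-mono A⇒B (yes _) (yes _) = ≤-refl
indicator-mono A⇒B (yes a) (no ¬b) = contradiction (A⇒B a) ¬b

private variable
  P Q : Pred ℕ 0ℓ

count : Decidable P → ℕ → ℕ
count P? zero    = 0
count P? (suc a) = indicator (P? 0) + count (P? ∘ suc) a

count-none : (P? : Decidable P) (a : ℕ) → (∀ j → j < a → ¬ P j) → count P? a ≡ 0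
count-none P? zero    _   = refl
count-none P? (suc a) ¬P with P? 0
... | yes p = contradiction p (¬P 0 (s≤s z≤n))
... | no  _ = count-none (P? ∘ suc) a (λ j j<a → ¬P (suc j) (s≤s j<a))

count-all : (P? : Decidable P) (a : ℕ) → (∀ j → j < a → P j) → count P? a ≡ a
count-all P? zero    _  = refl
count-all P? (suc a) P′ with P? 0
... | yes _ = cong suc (count-all (P? ∘ suc) a (λ j j<a → P′ (suc j) (s≤s j<a)))
... | no ¬p = contradiction (P′ 0 (s≤s z≤n)) ¬p

count-+ : (P? : Decidable P) (a b : ℕ) → count P? (a + b) ≡ count P? a + count (P? ∘ (a +_)) b
count-+ P? zero    b = refl
count-+ P? (suc a) b =
  trans (cong (indicator (P? 0) +_) (count-+ (P? ∘ suc) a b)) (sym (+-assoc (indicator (P? 0)) _ _))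

count-interval : (P? : Decidable P) {a b N : ℕ} → a ≤ b → b ≤ N →
                 (∀ j → j < N → P j ⇔ (a ≤ j × j < b)) → count P? N ≡ b ∸ a
count-interval {P = P} P? {a} {b} {N} a≤b b≤N P⇔ = begin
    count P? N
  ≡⟨ cong (count P?) (sym (trans (cong (_+ (N ∸ b)) a+s≡b) (m+[n∸m]≡n b≤N))) ⟩
    count P? (a + s + (N ∸ b))
  ≡⟨ count-+ P? (a + s) (N ∸ b) ⟩
    count P? (a + s) + count (P? ∘ (a + s +_)) (N ∸ b)
  ≡⟨ cong₂ _+_ (count-+ P? a s) (count-none _ (N ∸ b) after) ⟩
    count P? a + count (P? ∘ (a +_)) s + 0
  ≡⟨ cong (λ x → x + count (P? ∘ (a +_)) s + 0) (count-none P? a before) ⟩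
    count (P? ∘ (a +_)) s + 0
  ≡⟨ +-identityʳ _ ⟩
    count (P? ∘ (a +_)) s
  ≡⟨ count-all _ s inside ⟩
    s ∎
  where
  open ≡-Reasoning
  s = b ∸ a
  a+s≡b : a + s ≡ b
  a+s≡b = m+[n∸m]≡n a≤b
  before : ∀ j → j < a → ¬ P j
  before j j<a p = <⇒≱ j<a (proj₁ (Equivalence.to (P⇔ j (<-≤-trans j<a (≤-trans a≤b b≤N))) p))
  inside : ∀ j → j < s → P (a + j)
  inside j j<s = Equivalence.from (P⇔ (a + j) (<-≤-trans a+j<b b≤N)) (m≤m+n a j , a+j<b)
    where a+j<b = subst (a + j <_) a+s≡b (+-monoʳ-< a j<s)
  after : ∀ j → j < N ∸ b → ¬ P (a + s + j)
  after j j<e p = <⇒≱ (proj₂ (Equivalence.to (P⇔ _ a+s+j<N) p)) (subst (_≤ a + s + j) a+s≡b (m≤m+n (a + s) j))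
    where a+s+j<N = subst (_< N) (cong (_+ j) (sym a+s≡b)) (subst (b + j <_) (m+[n∸m]≡n b≤N) (+-monoʳ-< b j<e))

count-≤1 : (P? : Decidable P) (c a : ℕ) → (∀ j → j < a → P j → j ≡ c) → count P? a ≤ 1
count-≤1 P? c zero    _   = z≤n
count-≤1 P? c (suc a) P≡c with P? 0
... | yes p = ≤-reflexive (cong suc (count-none (P? ∘ suc) a λ j j<a q →
                0≢1+n (trans (P≡c 0 z<s p) (sym (P≡c (suc j) (s≤s j<a) q)))))
... | no  _ = count-≤1 (P? ∘ suc) (pred c) a (λ j j<a q → cong pred (P≡c (suc j) (s≤s j<a) q))

count-pos : (P? : Decidable P) {c a : ℕ} → c < a → P c → 1 ≤ count P? a
count-pos P? {zero}  {suc a} _         p with P? 0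
... | yes _ = s≤s z≤n
... | no ¬p = contradiction p ¬p
count-pos P? {suc c} {suc a} (s≤s c<a) p = ≤-trans (count-pos (P? ∘ suc) c<a p) (m≤n+m _ _)

count-mono : (P? : Decidable P) (Q? : Decidable Q) (a : ℕ) → (∀ j → j < a → P j → Q j) →
             count P? a ≤ count Q? a
count-mono P? Q? zero    _   = z≤n
count-mono P? Q? (suc a) P⇒Q =
  +-mono-≤ (indicator-mono (P⇒Q 0 (s≤s z≤n)) (P? 0) (Q? 0))
           (count-mono (P? ∘ suc) (Q? ∘ suc) a (λ j j<a → P⇒Q (suc j) (s≤s j<a)))

count-cong : (P? : Decidable P) (Q? : Decidable Q) (a : ℕ) → (∀ j → j < a → P j ⇔ Q j) →
             count P? a ≡ count Q? a
count-cong P? Q? a P⇔Q = ≤-antisym (count-mono P? Q? a (λ j j<a → Equivalence.to (P⇔Q j j<a)))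
                                   (count-mono Q? P? a (λ j j<a → Equivalence.from (P⇔Q j j<a)))

count-partition : (P? : Decidable P) (Q? : Decidable Q) (a : ℕ) →
                  count P? a ≡ count (λ j → P? j ×-dec Q? j) a + count (λ j → P? j ×-dec ¬? (Q? j)) a
count-partition P? Q? zero    = refl
count-partition P? Q? (suc a) with P? 0 | Q? 0 | count-partition (P? ∘ suc) (Q? ∘ suc) a
... | yes _ | yes _ | ih = cong suc ih
... | yes _ | no  _ | ih = trans (cong suc ih) (sym (+-suc _ _))
... | no  _ | yes _ | ih = ih
... | no  _ | no  _ | ih = ih

sumBelow : (ℕ → ℕ) → ℕ → ℕ
sumBelow f zero    = 0
sumBelow f (suc a) = f 0 + sumBelow (f ∘ suc) a

sumBelow-monoʳ : ∀ f {a b} → a ≤ b → sumBelow f a ≤ sumBelow f b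
sumBelow-monoʳ f {zero}          _         = z≤n
sumBelow-monoʳ f {suc a} {suc b} (s≤s a≤b) = +-monoʳ-≤ (f 0) (sumBelow-monoʳ (f ∘ suc) a≤b)

*-sumBelow : ∀ c f a → c * sumBelow f a ≡ sumBelow (λ j → c * f j) a
*-sumBelow c f zero    = *-zeroʳ c
*-sumBelow c f (suc a) = trans (*-distribˡ-+ c (f 0) _) (cong (c * f 0 +_) (*-sumBelow c (f ∘ suc) a))

sumBelow-∸ : ∀ a → 2 * sumBelow (a ∸_) a ≡ a * a + a
sumBelow-∸ zero    = refl
sumBelow-∸ (suc a) = begin
    2 * (suc a + sumBelow (a ∸_) a)  ≡⟨ *-distribˡ-+ 2 (suc a) _ ⟩
    2 * suc a + 2 * sumBelow (a ∸_) a ≡⟨ cong (2 * suc a +_) (sumBelow-∸ a) ⟩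
    2 * suc a + (a * a + a)           ≡⟨ square-step a ⟩
    suc a * suc a + suc a             ∎
  where
  open ≡-Reasoning
  square-step : ∀ a → 2 * suc a + (a * a + a) ≡ suc a * suc a + suc a
  square-step = solve-∀

sumBelow-∸suc : ∀ a → 2 * sumBelow (λ j → a ∸ suc j) a + a ≡ a * a
sumBelow-∸suc zero    = refl
sumBelow-∸suc (suc a) = begin
    2 * (a + sumBelow (λ j → a ∸ suc j) a) + suc a   ≡⟨ regroup a (sumBelow (λ j → a ∸ suc j) a) ⟩
    (2 * sumBelow (λ j → a ∸ suc j) a + a) + 2 * a + 1 ≡⟨ cong (λ x → x + 2 * a + 1) (sumBelow-∸suc a) ⟩
    a * a + 2 * a + 1                                  ≡⟨ square a ⟩
    suc a * suc a                                      ∎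
  where
  open ≡-Reasoning
  regroup : ∀ a s → 2 * (a + s) + suc a ≡ (2 * s + a) + 2 * a + 1
  regroup = solve-∀
  square : ∀ a → a * a + 2 * a + 1 ≡ suc a * suc a
  square = solve-∀

sum-tabulate-≤ : ∀ {n} (g : Fin n → ℕ) f → (∀ i → g i ≤ f (toℕ i)) → sum (tabulate g) ≤ sumBelow f n
sum-tabulate-≤ {zero}  g f g≤f = z≤n
sum-tabulate-≤ {suc n} g f g≤f = +-mono-≤ (g≤f Fin.zero) (sum-tabulate-≤ (g ∘ Fin.suc) (f ∘ suc) (g≤f ∘ Fin.suc))

sum-tabulate-≥ : ∀ {n} (g : Fin n → ℕ) f → (∀ i → f (toℕ i) ≤ g i) → sumBelow f n ≤ sum (tabulate g)
sum-tabulate-≥ {zero}  g f f≤g = z≤n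
sum-tabulate-≥ {suc n} g f f≤g = +-mono-≤ (f≤g Fin.zero) (sum-tabulate-≥ (g ∘ Fin.suc) (f ∘ suc) (f≤g ∘ Fin.suc))

sum-concatMap : {A : Set} (f : A → List ℕ) (xs : List A) → sum (concatMap f xs) ≡ sum (map (sum ∘ f) xs)
sum-concatMap f []       = refl
sum-concatMap f (x ∷ xs) = trans (sum-++ (f x) _) (cong (sum (f x) +_) (sum-concatMap f xs))

sum-≤-*length : {A : Set} (h : A → ℕ) (c : ℕ) (xs : List A) → (∀ x → h x ≤ c) → sum (map h xs) ≤ c * length xs
sum-≤-*length h c []       h≤c = z≤n
sum-≤-*length h c (x ∷ xs) h≤c = subst (h x + sum (map h xs) ≤_) (sym (*-suc c _))
                                       (+-mono-≤ (h≤c x) (sum-≤-*length h c xs h≤c))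

module _ {A : Set} {P Q : Pred A 0ℓ} (P? : Decidable P) (Q? : Decidable Q) where

  length-filter-mono : (∀ {x} → P x → Q x) → ∀ xs → length (filter P? xs) ≤ length (filter Q? xs)
  length-filter-mono P⇒Q xs = length-mono-≤ (filter⁺ P? Q? (λ { refl → P⇒Q }) (⊆-refl {x = xs}))

  *length-filter-≤-sum : (h : A → ℕ) (c : ℕ) → (∀ {x} → P x → Q x) → (∀ {x} → P x → c ≤ h x) →
                         ∀ xs → c * length (filter P? xs) ≤ sum (map h (filter Q? xs))
  *length-filter-≤-sum h c P⇒Q c≤h []       = ≤-reflexive (*-zeroʳ c)
  *length-filter-≤-sum h c P⇒Q c≤h (x ∷ xs) with ih ← *length-filter-≤-sum h c P⇒Q c≤h xs | P? x | Q? x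
  ... | yes p | yes _ = ≤-trans (≤-reflexive (*-suc c _)) (+-mono-≤ (c≤h p) ih)
  ... | yes p | no ¬q = contradiction (P⇒Q p) ¬q
  ... | no _  | yes _ = ≤-trans ih (m≤n+m _ _)
  ... | no _  | no _  = ih

length-filter-tabulate : ∀ {A : Set} {R : Pred A 0ℓ} {n} (R? : Decidable R) (g : Fin n → A) (P? : Decidable P) →
                         (∀ i → R (g i) ⇔ P (toℕ i)) → length (filter R? (tabulate g)) ≡ count P? n
length-filter-tabulate {n = zero}  R? g P? R⇔P = refl
length-filter-tabulate {n = suc n} R? g P? R⇔P
  with ih ← length-filter-tabulate R? (g ∘ Fin.suc) (P? ∘ suc) (R⇔P ∘ Fin.suc) | R? (g Fin.zero) | P? 0
... | yes _ | yes _ = cong suc ih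
... | no  _ | no  _ = ih
... | yes r | no ¬p = contradiction (Equivalence.to (R⇔P Fin.zero) r) ¬p
... | no ¬r | yes p = contradiction (Equivalence.from (R⇔P Fin.zero) p) ¬r

length-filter-allFin : ∀ n (P? : Decidable P) → length (filter (P? ∘ toℕ) (allFin n)) ≡ count P? n
length-filter-allFin n P? = length-filter-tabulate {n = n} (P? ∘ toℕ) id P? (λ _ → mk⇔ id id)

module Distance {n : ℕ} (G : Graph n) where

  record Walk (u v : Fin n) (d : ℕ) : Set where
    constructor walk
    field reaches : T (reach G u v d)
  open Walk

  EdgeLipschitz : (Fin n → ℕ) → Set
  EdgeLipschitz g = ∀ x y → T (adj G x y) → g y ≤ g x + 1

  walk-refl : ∀ u → Walk u u 0
  walk-refl u = walk (Equivalence.from T-≡ (dec-true (u Fin.≟ u) refl))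

  walk-zero⁻ : ∀ {u v} → Walk u v 0 → u ≡ v
  walk-zero⁻ {u} {v} (walk t) with u Fin.≟ v
  ... | yes u≡v = u≡v

  walk-suc⁺ : ∀ {u v} d → Walk u v d ⊎ (∃ λ w → Walk u w d × T (adj G w v)) → Walk u v (suc d)
  walk-suc⁺ d (inj₁ uv)            = walk (Equivalence.from T-∨ (inj₁ (reaches uv)))
  walk-suc⁺ d (inj₂ (w , uw , wv)) =
    walk (Equivalence.from T-∨ (inj₂ (any⁺ _ (lose (∈-allFin w) (Equivalence.from T-∧ (wv , reaches uw))))))

  walk-suc⁻ : ∀ {u v} d → Walk u v (suc d) → Walk u v d ⊎ (∃ λ w → Walk u w d × T (adj G w v))
  walk-suc⁻ {u} {v} d (walk t) with Equivalence.to (T-∨ {reach G u v d}) t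
  ... | inj₁ uv = inj₁ (walk uv)
  ... | inj₂ t′ with satisfied (any⁻ _ (allFin n) t′)
  ...   | w , wv∧uw with Equivalence.to (T-∧ {adj G w v}) wv∧uw
  ...     | wv , uw = inj₂ (w , walk uw , wv)

  walk-step : ∀ {u w v d} → Walk u w d → T (adj G w v) → Walk u v (suc d)
  walk-step uw wv = walk-suc⁺ _ (inj₂ (_ , uw , wv))

  walk-trans : ∀ {a b c} d₁ d₂ → Walk a b d₁ → Walk b c d₂ → Walk a c (d₁ + d₂)
  walk-trans d₁ zero ab bc = subst₂ (Walk _) (walk-zero⁻ bc) (sym (+-identityʳ d₁)) ab
  walk-trans d₁ (suc d₂) ab bc rewrite +-suc d₁ d₂ with walk-suc⁻ d₂ bc
  ... | inj₁ bc′           = walk-suc⁺ _ (inj₁ (walk-trans d₁ d₂ ab bc′))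
  ... | inj₂ (w , bw , wc) = walk-step (walk-trans d₁ d₂ ab bw) wc

  walk-sym : ∀ {a b} d → Walk a b d → Walk b a d
  walk-sym zero ab with refl ← walk-zero⁻ ab = walk-refl _
  walk-sym (suc d) ab with walk-suc⁻ d ab
  ... | inj₁ ab′           = walk-suc⁺ d (inj₁ (walk-sym d ab′))
  ... | inj₂ (w , aw , wb) =
    walk-trans 1 d (walk-step (walk-refl _) (subst T (Graph.sym G _ _) wb)) (walk-sym d aw)

  walk-potential : ∀ {g} → EdgeLipschitz g → ∀ {a b} d → Walk a b d → g b ≤ g a + d
  walk-potential lip zero ab with refl ← walk-zero⁻ ab = m≤m+n _ 0
  walk-potential {g} lip {a} (suc d) ab with walk-suc⁻ d ab
  ... | inj₁ ab′           = ≤-trans (walk-potential lip d ab′) (+-monoʳ-≤ (g a) (n≤1+n d))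
  ... | inj₂ (w , aw , wb) = begin
      g _           ≤⟨ lip w _ wb ⟩
      g w + 1       ≤⟨ +-monoˡ-≤ 1 (walk-potential lip d aw) ⟩
      g a + d + 1   ≡⟨ +-assoc (g a) d 1 ⟩
      g a + (d + 1) ≡⟨ cong (g a +_) (+-comm d 1) ⟩
      g a + suc d   ∎
    where open ≤-Reasoning

  private
    search-≤ : ∀ a b s f d → s ≤ d → Walk a b d → search G a b s f ≤ d
    search-≤ a b s zero    d s≤d _  = s≤d
    search-≤ a b s (suc f) d s≤d ab with reach G a b s in eq
    ... | true  = s≤d
    ... | false with m≤n⇒m<n∨m≡n s≤d
    ...   | inj₁ s<d  = search-≤ a b (suc s) f d s<d ab
    ...   | inj₂ refl = contradiction (subst T eq (reaches ab)) λ ()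

    search-≤-bound : ∀ a b s f → search G a b s f ≤ s + f
    search-≤-bound a b s zero    = m≤m+n s 0
    search-≤-bound a b s (suc f) with reach G a b s
    ... | true  = m≤m+n s (suc f)
    ... | false = subst (search G a b (suc s) f ≤_) (sym (+-suc s f)) (search-≤-bound a b (suc s) f)

    search-walk : ∀ a b s f → search G a b s f ≡ s + f ⊎ Walk a b (search G a b s f)
    search-walk a b s zero    = inj₁ (sym (+-identityʳ s))
    search-walk a b s (suc f) with reach G a b s in eq
    ... | true  = inj₂ (walk (subst T (sym eq) _))
    ... | false with search-walk a b (suc s) f
    ...   | inj₁ e  = inj₁ (trans e (sym (+-suc s f)))
    ...   | inj₂ ab = inj₂ ab

  dist≤ : ∀ {a b} d → Walk a b d → dist G a b ≤ d
  dist≤ d ab = search-≤ _ _ 0 n d z≤n ab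

  dist≤n : ∀ a b → dist G a b ≤ n
  dist≤n a b = search-≤-bound a b 0 n

  -- a distance is either realised by a walk or equal to n
  ≤dist : ∀ {a b} c → c ≤ n → (∀ d → Walk a b d → c ≤ d) → c ≤ dist G a b
  ≤dist {a} {b} c c≤n c≤walk with search-walk a b 0 n
  ... | inj₁ e  = subst (c ≤_) (sym e) c≤n
  ... | inj₂ ab = c≤walk _ ab

  potential-gap≤dist : ∀ g → EdgeLipschitz g → ∀ a b → g b ∸ g a ≤ n → g b ∸ g a ≤ dist G a b
  potential-gap≤dist g lip a b gap≤n = ≤dist _ gap≤n λ d ab →
    subst (g b ∸ g a ≤_) (m+n∸m≡n (g a) d) (∸-monoˡ-≤ (g a) (walk-potential lip d ab))

module MostarSums {n : ℕ} (G : Graph n) where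

  mostarTerm : Fin n → Fin n → ℕ
  mostarTerm u v = ∣ nG G u v - nG G v u ∣

  laterVertices : Fin n → List (Fin n)
  laterVertices u = filter (T? ∘ (λ v → toℕ u <ᵇ toℕ v)) (allFin n)

  rowSum : Fin n → ℕ
  rowSum u = sum (map (mostarTerm u) (laterVertices u))

  totalMostar≡sum-rowSum : totalMostar G ≡ sum (tabulate rowSum)
  totalMostar≡sum-rowSum = trans (sum-concatMap _ (allFin n)) (cong sum (map-tabulate id rowSum))

  nG≤n : ∀ u v → nG G u v ≤ n
  nG≤n u v = ≤-trans (length-filter _ (allFin n)) (≤-reflexive (length-tabulate id))

  mostarTerm≤n : ∀ u v → mostarTerm u v ≤ n
  mostarTerm≤n u v = ≤-trans (∣m-n∣≤m⊔n (nG G u v) (nG G v u)) (⊔-lub (nG≤n u v) (nG≤n v u))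

  length-laterVertices : ∀ u → length (laterVertices u) ≡ n ∸ suc (toℕ u)
  length-laterVertices u = begin
      length (laterVertices u)
    ≡⟨ length-filter-tabulate {n = n} (T? ∘ (λ v → toℕ u <ᵇ toℕ v)) id (toℕ u <?_) (λ v → mk⇔ (<ᵇ⇒< _ _) <⇒<ᵇ) ⟩
      count (toℕ u <?_) n
    ≡⟨ count-interval (toℕ u <?_) {N = n} (toℕ<n u) ≤-refl (λ j j<n → mk⇔ (_, j<n) proj₁) ⟩
      n ∸ suc (toℕ u) ∎
    where open ≡-Reasoning

  rowSum≤ : ∀ u → rowSum u ≤ n * (n ∸ suc (toℕ u))
  rowSum≤ u = ≤-trans (sum-≤-*length (mostarTerm u) n (laterVertices u) (mostarTerm≤n u))
                      (≤-reflexive (cong (n *_) (length-laterVertices u)))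

  2*totalMostar≤n^3 : 2 * totalMostar G ≤ n ^ 3
  2*totalMostar≤n^3 = begin
      2 * totalMostar G                              ≡⟨ cong (2 *_) totalMostar≡sum-rowSum ⟩
      2 * sum (tabulate rowSum)                      ≤⟨ *-monoʳ-≤ 2 (sum-tabulate-≤ rowSum _ rowSum≤) ⟩
      2 * sumBelow (λ j → n * (n ∸ suc j)) n         ≡⟨ cong (2 *_) (sym (*-sumBelow n _ n)) ⟩
      2 * (n * pairs)                                ≡⟨ x∙yz≈y∙xz *-commutativeSemigroup 2 n pairs ⟩
      n * (2 * pairs)                                ≤⟨ *-monoʳ-≤ n (m+n≤o⇒m≤o (2 * pairs) (≤-reflexive (sumBelow-∸suc n))) ⟩
      n * (n * n)                                    ≡⟨ cong (λ x → n * (n * x)) (sym (*-identityʳ n)) ⟩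
      n ^ 3                                          ∎
    where
    open ≤-Reasoning
    pairs = sumBelow (λ j → n ∸ suc j) n

  c*A²≤2*totalMostar : ∀ c A → A ≤ n → (∀ u → c * (A ∸ toℕ u) ≤ rowSum u) → c * (A * A) ≤ 2 * totalMostar G
  c*A²≤2*totalMostar c A A≤n c*[A∸u]≤row = begin
      c * (A * A)                                    ≤⟨ *-monoʳ-≤ c (≤-trans (m≤m+n (A * A) A) (≤-reflexive (sym (sumBelow-∸ A)))) ⟩
      c * (2 * sumBelow (A ∸_) A)                    ≤⟨ *-monoʳ-≤ c (*-monoʳ-≤ 2 (sumBelow-monoʳ (A ∸_) A≤n)) ⟩
      c * (2 * sumBelow (A ∸_) n)                    ≡⟨ x∙yz≈y∙xz *-commutativeSemigroup c 2 _ ⟩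
      2 * (c * sumBelow (A ∸_) n)                    ≡⟨ cong (2 *_) (*-sumBelow c (A ∸_) n) ⟩
      2 * sumBelow (λ j → c * (A ∸ j)) n             ≤⟨ *-monoʳ-≤ 2 (sum-tabulate-≥ rowSum _ c*[A∸u]≤row) ⟩
      2 * sum (tabulate rowSum)                      ≡⟨ cong (2 *_) (sym totalMostar≡sum-rowSum) ⟩
      2 * totalMostar G                              ∎
    where
    open ≤-Reasoning

module Degeneracy {n : ℕ} (G : Graph n) where

  lowerNeighbours : (Fin n → ℕ) → Fin n → List (Fin n)
  lowerNeighbours rank v = filter (λ w → T? (adj G v w) ×-dec (rank w ≤? rank v)) (allFin n)

  -- in any subgraph, a vertex of maximal rank keeps only neighbours of lower or equal rank
  lowDegree-fromRanking : ∀ k (rank : Fin n → ℕ) → (∀ v → length (lowerNeighbours rank v) ≤ k) →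
                          EverySubgraphHasLowDeg G k
  lowDegree-fromRanking k rank few-lower K (v₀ , v₀∈K) = top , top∈K , degree≤k
    where
    inK = filter (T? ∘ S K) (allFin n)
    top = argmax rank v₀ inK
    top∈K : S K top ≡ true
    top∈K with argmax-sel rank v₀ inK
    ... | inj₁ top≡v₀ = trans (cong (S K) top≡v₀) v₀∈K
    ... | inj₂ top∈   = Equivalence.to T-≡ (proj₂ (∈-filter⁻ (T? ∘ S K) {xs = allFin n} top∈))
    top-maximal : ∀ {w} → S K w ≡ true → rank w ≤ rank top
    top-maximal {w} w∈K =
      All.lookup (f[xs]≤f[argmax] v₀ inK) (∈-filter⁺ (T? ∘ S K) (∈-allFin w) (Equivalence.from T-≡ w∈K))
    lower : ∀ {w} → T (H K top w) → T (adj G top w) × rank w ≤ rank top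
    lower {w} t = Equivalence.from T-≡ (H⊆G K top w e) , top-maximal (proj₂ (H⊆S K top w e))
      where e = Equivalence.to T-≡ t
    degree≤k : degIn K top ≤ k
    degree≤k = ≤-trans (length-filter-mono (T? ∘ H K top) _ lower (allFin n)) (few-lower top)

  ¬lowDegree-fromSubgraph : ∀ j (K : Subgraph G) → (∃ λ v → S K v ≡ true) →
                            (∀ v → S K v ≡ true → j < degIn K v) → ¬ EverySubgraphHasLowDeg G j
  ¬lowDegree-fromSubgraph j K nonempty high low with low K nonempty
  ... | v , v∈K , degree≤j = <⇒≱ (high v v∈K) degree≤j

module SpiderWithClique (n k ℓ L : ℕ) {{_ : NonZero ℓ}} (1≤k : 1 ≤ k) (2≤ℓ : 2 ≤ ℓ) (fits : L * ℓ + k + 2 ≤ n)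
  where

  -- vertices j < M form ℓ legs of length L (leg j % ℓ, depth j / ℓ + 1), M is the hub,
  -- M + 1, ..., M + k + 1 form a clique, and the remaining vertices are isolated
  M : ℕ
  M = L * ℓ

  1+M<M+k+2 : suc M < M + k + 2
  1+M<M+k+2 = subst (_≤ M + k + 2) (+-comm M 2) (+-monoˡ-≤ 2 (m≤m+n M k))

  1+M<n : suc M < n
  1+M<n = <-≤-trans 1+M<M+k+2 fits

  M<n : M < n
  M<n = <-trans (n<1+n M) 1+M<n

  InClique : ℕ → Set
  InClique j = M < j × j < M + k + 2

  inClique? : Decidable InClique
  inClique? j = (M <? j) ×-dec (j <? M + k + 2)

  LegStep Spoke CliquePair : ℕ → ℕ → Set
  LegStep a b    = a + ℓ ≡ b × b < M
  Spoke a b      = a ≡ M × b < ℓ × b < M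
  CliquePair a b = InClique a × InClique b × a ≢ b

  cliquePair? : ∀ a → Decidable (CliquePair a)
  cliquePair? a b = inClique? a ×-dec (inClique? b ×-dec ¬? (a ≟ b))

  data Edge (a b : ℕ) : Set where
    step   : LegStep a b → Edge a b
    step⁻  : LegStep b a → Edge a b
    spoke  : Spoke a b → Edge a b
    spoke⁻ : Spoke b a → Edge a b
    clique : CliquePair a b → Edge a b

  edge? : ∀ a b → Dec (Edge a b)
  edge? a b = map′ from⊎ to⊎
    (legStep? a b ⊎-dec (legStep? b a ⊎-dec (spoke? a b ⊎-dec (spoke? b a ⊎-dec cliquePair? a b))))
    where
    legStep? : ∀ a b → Dec (LegStep a b)
    legStep? a b = (a + ℓ ≟ b) ×-dec (b <? M)
    spoke? : ∀ a b → Dec (Spoke a b)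
    spoke? a b = (a ≟ M) ×-dec ((b <? ℓ) ×-dec (b <? M))
    from⊎ : LegStep a b ⊎ LegStep b a ⊎ Spoke a b ⊎ Spoke b a ⊎ CliquePair a b → Edge a b
    from⊎ (inj₁ e)                         = step e
    from⊎ (inj₂ (inj₁ e))                  = step⁻ e
    from⊎ (inj₂ (inj₂ (inj₁ e)))           = spoke e
    from⊎ (inj₂ (inj₂ (inj₂ (inj₁ e))))    = spoke⁻ e
    from⊎ (inj₂ (inj₂ (inj₂ (inj₂ e))))    = clique e
    to⊎ : Edge a b → LegStep a b ⊎ LegStep b a ⊎ Spoke a b ⊎ Spoke b a ⊎ CliquePair a b
    to⊎ (step e)   = inj₁ e
    to⊎ (step⁻ e)  = inj₂ (inj₁ e)
    to⊎ (spoke e)  = inj₂ (inj₂ (inj₁ e))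
    to⊎ (spoke⁻ e) = inj₂ (inj₂ (inj₂ (inj₁ e)))
    to⊎ (clique e) = inj₂ (inj₂ (inj₂ (inj₂ e)))

  a+ℓ≢a : ∀ {a} → a + ℓ ≢ a
  a+ℓ≢a {a} a+ℓ≡a = <-irrefl (sym a+ℓ≡a) (m<m+n a (>-nonZero⁻¹ ℓ))

  Edge-sym : ∀ {a b} → Edge a b → Edge b a
  Edge-sym (step e)                 = step⁻ e
  Edge-sym (step⁻ e)                = step e
  Edge-sym (spoke e)                = spoke⁻ e
  Edge-sym (spoke⁻ e)               = spoke e
  Edge-sym (clique (ca , cb , a≢b)) = clique (cb , ca , a≢b ∘ sym)

  Edge-irrefl : ∀ {a} → ¬ Edge a a
  Edge-irrefl (step (a+ℓ≡a , _))        = a+ℓ≢a a+ℓ≡a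
  Edge-irrefl (step⁻ (a+ℓ≡a , _))       = a+ℓ≢a a+ℓ≡a
  Edge-irrefl (spoke (refl , _ , M<M))  = <-irrefl refl M<M
  Edge-irrefl (spoke⁻ (refl , _ , M<M)) = <-irrefl refl M<M
  Edge-irrefl (clique (_ , _ , a≢a))    = a≢a refl

  G : Graph n
  G = record
    { adj    = λ u v → does (edge? (toℕ u) (toℕ v))
    ; sym    = λ u v → does-⇔ (mk⇔ Edge-sym Edge-sym) (edge? (toℕ u) (toℕ v)) (edge? (toℕ v) (toℕ u))
    ; irrefl = λ v → dec-false (edge? (toℕ v) (toℕ v)) Edge-irrefl
    }

  open Distance G

  adj⁺ : ∀ {u v} → Edge (toℕ u) (toℕ v) → T (adj G u v)
  adj⁺ = ⇒does (edge? _ _)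

  adj⁻ : ∀ {u v} → T (adj G u v) → Edge (toℕ u) (toℕ v)
  adj⁻ = does⇒ (edge? _ _)

  lipschitz-on-vertices : (π : ℕ → ℕ) → (∀ {a b} → Edge a b → π b ≤ π a + 1) → EdgeLipschitz (π ∘ toℕ)
  lipschitz-on-vertices π lip x y = lip ∘ adj⁻ {x} {y}

  hub : Fin n
  hub = fromℕ< M<n

  depth : ℕ → ℕ
  depth j = if does (j <? M) then suc (j / ℓ) else 0

  depth-leg : ∀ {j} → j < M → depth j ≡ suc (j / ℓ)
  depth-leg {j} j<M rewrite dec-true (j <? M) j<M = refl

  depth-≥M : ∀ {j} → M ≤ j → depth j ≡ 0
  depth-≥M {j} M≤j rewrite dec-false (j <? M) (≤⇒≯ M≤j) = refl

  walk-from-hub-to-leg : ∀ t x → toℕ x < M → toℕ x / ℓ ≡ t → Walk hub x (suc t)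
  walk-from-hub-to-leg zero    x x<M x/ℓ≡0 =
    walk-step (walk-refl hub) (adj⁺ (spoke (toℕ-fromℕ< M<n , m/n≡0⇒m<n x/ℓ≡0 , x<M)))
  walk-from-hub-to-leg (suc t) x x<M x/ℓ≡1+t =
    walk-step (walk-from-hub-to-leg t y y<M y/ℓ≡t) (adj⁺ (step (y+ℓ≡x , x<M)))
    where
    ℓ≤x : ℓ ≤ toℕ x
    ℓ≤x = m/n≢0⇒n≤m (λ x/ℓ≡0 → 0≢1+n (trans (sym x/ℓ≡0) x/ℓ≡1+t))
    x∸ℓ<M : toℕ x ∸ ℓ < M
    x∸ℓ<M = ≤-<-trans (m∸n≤m (toℕ x) ℓ) x<M
    y = fromℕ< (<-trans x∸ℓ<M M<n)
    toℕ-y : toℕ y ≡ toℕ x ∸ ℓ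
    toℕ-y = toℕ-fromℕ< _
    y<M : toℕ y < M
    y<M = subst (_< M) (sym toℕ-y) x∸ℓ<M
    y/ℓ≡t : toℕ y / ℓ ≡ t
    y/ℓ≡t = trans (cong (_/ ℓ) toℕ-y) (trans ([m∸n]/n≡m/n∸1 (toℕ x) ℓ) (cong pred x/ℓ≡1+t))
    y+ℓ≡x : toℕ y + ℓ ≡ toℕ x
    y+ℓ≡x = trans (cong (_+ ℓ) toℕ-y) (m∸n+n≡m ℓ≤x)

  walk-from-hub : ∀ x → toℕ x ≤ M → Walk hub x (depth (toℕ x))
  walk-from-hub x x≤M with m≤n⇒m<n∨m≡n x≤M
  ... | inj₁ x<M rewrite depth-leg x<M = walk-from-hub-to-leg _ x x<M refl
  ... | inj₂ x≡M rewrite x≡M | depth-≥M (≤-refl {M}) | toℕ-injective (trans x≡M (sym (toℕ-fromℕ< M<n)))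
    = walk-refl hub

  dist-via-hub : ∀ w u → toℕ w ≤ M → toℕ u ≤ M → dist G w u ≤ depth (toℕ w) + depth (toℕ u)
  dist-via-hub w u w≤M u≤M =
    dist≤ _ (walk-trans (depth (toℕ w)) _ (walk-sym _ (walk-from-hub w w≤M)) (walk-from-hub u u≤M))

  [a+ℓ]/ℓ≡1+a/ℓ : ∀ a → (a + ℓ) / ℓ ≡ suc (a / ℓ)
  [a+ℓ]/ℓ≡1+a/ℓ a = trans (m/n≡1+[m∸n]/n (m≤n+m ℓ a)) (cong (λ x → suc (x / ℓ)) (m+n∸n≡m a ℓ))

  depth-step : ∀ {a} → a + ℓ < M → depth (a + ℓ) ≡ suc (depth a)
  depth-step {a} a+ℓ<M = begin
      depth (a + ℓ)      ≡⟨ depth-leg a+ℓ<M ⟩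
      suc ((a + ℓ) / ℓ)  ≡⟨ cong suc ([a+ℓ]/ℓ≡1+a/ℓ a) ⟩
      suc (suc (a / ℓ))  ≡⟨ cong suc (depth-leg (≤-<-trans (m≤m+n a ℓ) a+ℓ<M)) ⟨
      suc (depth a)      ∎
    where open ≡-Reasoning

  depth≤L : ∀ {j} → j ≤ M → depth j ≤ L
  depth≤L {j} j≤M with m≤n⇒m<n∨m≡n j≤M
  ... | inj₁ j<M = subst (_≤ L) (sym (depth-leg j<M)) (m<n*o⇒m/o<n j<M)
  ... | inj₂ refl = subst (_≤ L) (sym (depth-≥M ≤-refl)) z≤n

  2L≤M : L + L ≤ M
  2L≤M = ≤-trans (≤-reflexive (trans (cong (L +_) (sym (+-identityʳ L))) (*-comm 2 L))) (*-monoʳ-≤ L 2≤ℓ)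

  OnLeg : ℕ → ℕ → Set
  OnLeg r j = j < M × j % ℓ ≡ r

  onLeg? : ∀ r → Decidable (OnLeg r)
  onLeg? r j = (j <? M) ×-dec (j % ℓ ≟ r)

  offset : Bool → ℕ → ℕ
  offset true  d = L + d
  offset false d = L ∸ d

  offset-suc-≤ : ∀ c d → offset c (suc d) ≤ offset c d + 1
  offset-suc-≤ true  d = ≤-reflexive (trans (+-suc L d) (+-comm 1 (L + d)))
  offset-suc-≤ false d = ≤-trans (∸-monoʳ-≤ L (n≤1+n d)) (m≤m+n _ 1)

  offset-≤-suc : ∀ c d → offset c d ≤ offset c (suc d) + 1
  offset-≤-suc true  d = ≤-trans (n≤1+n _) (≤-trans (≤-reflexive (sym (+-suc L d))) (m≤m+n _ 1))
  offset-≤-suc false d = ≤-trans (m≤n+m∸n (L ∸ d) 1) (≤-reflexive (trans (+-comm 1 _) (cong (_+ 1) L∸d∸1≡L∸[1+d])))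
    where L∸d∸1≡L∸[1+d] = trans (∸-+-assoc L d 1) (cong (L ∸_) (+-comm d 1))

  -- L + depth along the leg r, L − depth elsewhere: a 1-Lipschitz function separating leg r from the rest
  legPotential : ℕ → ℕ → ℕ
  legPotential r j = offset (does (onLeg? r j)) (depth j)

  legPotential-≥M : ∀ r {j} → M ≤ j → legPotential r j ≡ L
  legPotential-≥M r {j} M≤j rewrite dec-false (onLeg? r j) (≤⇒≯ M≤j ∘ proj₁) | depth-≥M M≤j = refl

  legPotential-step : ∀ r {a} → a + ℓ < M → legPotential r (a + ℓ) ≡ offset (does (onLeg? r a)) (suc (depth a))
  legPotential-step r {a} a+ℓ<M = cong₂ offset same-leg (depth-step a+ℓ<M)
    where
    same-leg = does-⇔ (mk⇔ (λ (_ , a+ℓ%ℓ) → ≤-<-trans (m≤m+n a ℓ) a+ℓ<M , trans (sym ([m+n]%n≡m%n a ℓ)) a+ℓ%ℓ)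
                           (λ (_ , a%ℓ) → a+ℓ<M , trans ([m+n]%n≡m%n a ℓ) a%ℓ))
                      (onLeg? r (a + ℓ)) (onLeg? r a)

  legPotential-firstVertex : ∀ r {b} → b < ℓ → b < M → legPotential r b ≡ offset (does (onLeg? r b)) 1
  legPotential-firstVertex r {b} b<ℓ b<M =
    cong (offset (does (onLeg? r b))) (trans (depth-leg b<M) (cong suc (m<n⇒m/n≡0 b<ℓ)))

  offset-1-≤ : ∀ c → offset c 1 ≤ L + 1
  offset-1-≤ true  = ≤-refl
  offset-1-≤ false = ≤-trans (m∸n≤m L 1) (m≤m+n L 1)

  ≤-offset-1 : ∀ c → L ≤ offset c 1 + 1
  ≤-offset-1 true  = ≤-trans (m≤m+n L 1) (m≤m+n (L + 1) 1)
  ≤-offset-1 false = ≤-trans (m≤n+m∸n L 1) (≤-reflexive (+-comm 1 (L ∸ 1)))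

  legPotential-lipschitz : ∀ r {a b} → Edge a b → legPotential r b ≤ legPotential r a + 1
  legPotential-lipschitz r {a} (step (refl , b<M))
    rewrite legPotential-step r b<M = offset-suc-≤ (does (onLeg? r a)) (depth a)
  legPotential-lipschitz r {b = b} (step⁻ (refl , a<M))
    rewrite legPotential-step r a<M = offset-≤-suc (does (onLeg? r b)) (depth b)
  legPotential-lipschitz r {b = b} (spoke (refl , b<ℓ , b<M))
    rewrite legPotential-≥M r (≤-refl {M}) | legPotential-firstVertex r b<ℓ b<M = offset-1-≤ (does (onLeg? r b))
  legPotential-lipschitz r {a} (spoke⁻ (refl , a<ℓ , a<M))
    rewrite legPotential-≥M r (≤-refl {M}) | legPotential-firstVertex r a<ℓ a<M = ≤-offset-1 (does (onLeg? r a))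
  legPotential-lipschitz r (clique ((M<a , _) , (M<b , _) , _))
    rewrite legPotential-≥M r (<⇒≤ M<a) | legPotential-≥M r (<⇒≤ M<b) = m≤m+n L 1

  Edge-spider : ∀ {a b} → Edge a b → a ≤ M → b ≤ M
  Edge-spider (step (refl , b<M))      _   = <⇒≤ b<M
  Edge-spider (step⁻ (refl , _))       a≤M = ≤-trans (m≤m+n _ ℓ) a≤M
  Edge-spider (spoke (_ , _ , b<M))    _   = <⇒≤ b<M
  Edge-spider (spoke⁻ (refl , _))      _   = ≤-refl
  Edge-spider (clique ((M<a , _) , _)) a≤M = contradiction a≤M (<⇒≱ M<a)

  spiderPotential : ℕ → ℕ
  spiderPotential j = if does (j ≤? M) then n else 0

  spiderPotential-lipschitz : ∀ {a b} → Edge a b → spiderPotential b ≤ spiderPotential a + 1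
  spiderPotential-lipschitz {a} {b} e with b ≤? M
  ... | no  b≰M rewrite dec-false (b ≤? M) b≰M = z≤n
  ... | yes b≤M rewrite dec-true (b ≤? M) b≤M | dec-true (a ≤? M) (Edge-spider (Edge-sym e) b≤M) = m≤m+n n 1

  off-spider-far : ∀ w v → M < toℕ w → toℕ v ≤ M → n ≤ dist G w v
  off-spider-far w v M<w v≤M = subst (_≤ dist G w v) gap≡n
    (potential-gap≤dist _ (lipschitz-on-vertices spiderPotential spiderPotential-lipschitz) w v (≤-reflexive gap≡n))
    where
    gap≡n : spiderPotential (toℕ v) ∸ spiderPotential (toℕ w) ≡ n
    gap≡n rewrite dec-true (toℕ v ≤? M) v≤M | dec-false (toℕ w ≤? M) (<⇒≱ M<w) = refl

  off-leg-far : ∀ w v → toℕ w ≤ M → toℕ v < M → ¬ OnLeg (toℕ v % ℓ) (toℕ w) →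
                depth (toℕ w) + depth (toℕ v) ≤ dist G w v
  off-leg-far w v w≤M v<M w∉leg = subst (_≤ dist G w v) gap≡
    (potential-gap≤dist _ (lipschitz-on-vertices (legPotential r) (legPotential-lipschitz r)) w v (subst (_≤ n) (sym gap≡) dw+dv≤n))
    where
    r = toℕ v % ℓ
    dw = depth (toℕ w)
    dv = depth (toℕ v)
    gap≡ : legPotential r (toℕ v) ∸ legPotential r (toℕ w) ≡ dw + dv
    gap≡ rewrite dec-true (onLeg? r (toℕ v)) (v<M , refl) | dec-false (onLeg? r (toℕ w)) w∉leg
      = trans (+-∸-comm dv (m∸n≤m L dw)) (cong (_+ dv) (m∸[m∸n]≡n (depth≤L w≤M)))
    dw+dv≤n : dw + dv ≤ n
    dw+dv≤n = ≤-trans (+-mono-≤ (depth≤L w≤M) (depth≤L (<⇒≤ v<M))) (≤-trans 2L≤M (<⇒≤ M<n))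

  closer-to-shallower : ∀ u v w → toℕ u < M → toℕ v < M → toℕ u / ℓ < toℕ v / ℓ →
                        toℕ w ≤ M → ¬ OnLeg (toℕ v % ℓ) (toℕ w) → dist G w u < dist G w v
  closer-to-shallower u v w u<M v<M u/ℓ<v/ℓ w≤M w∉leg = begin-strict
      dist G w u                      ≤⟨ dist-via-hub w u w≤M (<⇒≤ u<M) ⟩
      depth (toℕ w) + depth (toℕ u)   ≡⟨ cong (depth (toℕ w) +_) (depth-leg u<M) ⟩
      depth (toℕ w) + suc (toℕ u / ℓ) <⟨ +-monoʳ-< (depth (toℕ w)) (s≤s u/ℓ<v/ℓ) ⟩
      depth (toℕ w) + suc (toℕ v / ℓ) ≡⟨ cong (depth (toℕ w) +_) (depth-leg v<M) ⟨
      depth (toℕ w) + depth (toℕ v)   ≤⟨ off-leg-far w v w≤M v<M w∉leg ⟩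
      dist G w v                      ∎
    where open ≤-Reasoning

  closer-to-deeper⇒onLeg : ∀ u v w → toℕ u < M → toℕ v < M → toℕ u / ℓ < toℕ v / ℓ →
                           dist G w v < dist G w u → OnLeg (toℕ v % ℓ) (toℕ w)
  closer-to-deeper⇒onLeg u v w u<M v<M u/ℓ<v/ℓ v-closer with onLeg? (toℕ v % ℓ) (toℕ w) | ≤-<-connex (toℕ w) M
  ... | yes w∈leg | _       = w∈leg
  ... | no  w∉leg | inj₁ w≤M = contradiction (closer-to-shallower u v w u<M v<M u/ℓ<v/ℓ w≤M w∉leg) (<-asym v-closer)
  ... | no  w∉leg | inj₂ M<w =
    contradiction (≤-trans (dist≤n w u) (off-spider-far w v M<w (<⇒≤ v<M))) (<⇒≱ v-closer)

  residue-count : ∀ r t → count (λ j → j % ℓ ≟ r) (t * ℓ) ≤ t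
  residue-count r zero    = z≤n
  residue-count r (suc t) = begin
      count (λ j → j % ℓ ≟ r) (ℓ + t * ℓ)
    ≡⟨ count-+ (λ j → j % ℓ ≟ r) ℓ (t * ℓ) ⟩
      count (λ j → j % ℓ ≟ r) ℓ + count (λ j → (ℓ + j) % ℓ ≟ r) (t * ℓ)
    ≡⟨ cong (count (λ j → j % ℓ ≟ r) ℓ +_)
            (count-cong _ _ (t * ℓ) λ j _ → mk⇔ (trans (sym (ℓ+j%ℓ j))) (trans (ℓ+j%ℓ j))) ⟩
      count (λ j → j % ℓ ≟ r) ℓ + count (λ j → j % ℓ ≟ r) (t * ℓ)
    ≤⟨ +-mono-≤ (count-≤1 _ r ℓ λ j j<ℓ j%ℓ≡r → trans (sym (m<n⇒m%n≡m j<ℓ)) j%ℓ≡r) (residue-count r t) ⟩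
      suc t ∎
    where
    open ≤-Reasoning
    ℓ+j%ℓ : ∀ j → (ℓ + j) % ℓ ≡ j % ℓ
    ℓ+j%ℓ j = trans (cong (_% ℓ) (+-comm ℓ j)) ([m+n]%n≡m%n j ℓ)

  leg-count : ∀ r → count (onLeg? r) n ≤ L
  leg-count r = begin
      count (onLeg? r) n                                       ≡⟨ cong (count (onLeg? r)) (sym (m+[n∸m]≡n (<⇒≤ M<n))) ⟩
      count (onLeg? r) (M + (n ∸ M))                           ≡⟨ count-+ (onLeg? r) M (n ∸ M) ⟩
      count (onLeg? r) M + count (onLeg? r ∘ (M +_)) (n ∸ M)   ≡⟨ cong (count (onLeg? r) M +_) beyond-M ⟩
      count (onLeg? r) M + 0                                   ≤⟨ +-monoˡ-≤ 0 (count-mono _ _ M λ _ _ → proj₂) ⟩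
      count (λ j → j % ℓ ≟ r) M + 0                            ≤⟨ +-monoˡ-≤ 0 (residue-count r L) ⟩
      L + 0                                                    ≡⟨ +-identityʳ L ⟩
      L                                                        ∎
    where
    open ≤-Reasoning
    beyond-M = count-none (onLeg? r ∘ (M +_)) (n ∸ M) λ j _ (M+j<M , _) → m+n≮m M j M+j<M

  OffLeg : ℕ → ℕ → Set
  OffLeg r j = j ≤ M × ¬ OnLeg r j

  offLeg? : ∀ r → Decidable (OffLeg r)
  offLeg? r j = (j ≤? M) ×-dec ¬? (onLeg? r j)

  offLeg-count : ∀ r → suc M ∸ L ≤ count (offLeg? r) n
  offLeg-count r = begin
      suc M ∸ L                                         ≡⟨ cong (_∸ L) spider-count ⟨
      count (_≤? M) n ∸ L                               ≡⟨ cong (_∸ L) (count-partition (_≤? M) (onLeg? r) n) ⟩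
      (onSpiderLeg + count (offLeg? r) n) ∸ L           ≤⟨ ∸-monoʳ-≤ _ onSpiderLeg≤L ⟩
      (onSpiderLeg + count (offLeg? r) n) ∸ onSpiderLeg ≡⟨ m+n∸m≡n onSpiderLeg _ ⟩
      count (offLeg? r) n                               ∎
    where
    open ≤-Reasoning
    onSpiderLeg = count (λ j → (j ≤? M) ×-dec onLeg? r j) n
    onSpiderLeg≤L : onSpiderLeg ≤ L
    onSpiderLeg≤L = ≤-trans (count-mono _ _ n λ _ _ → proj₂) (leg-count r)
    spider-count : count (_≤? M) n ≡ suc M
    spider-count = count-interval (_≤? M) z≤n M<n λ j _ → mk⇔ (λ j≤M → z≤n , s≤s j≤M) (λ (_ , j<1+M) → ≤-pred j<1+M)

  open MostarSums G

  mostarTerm-legs : ∀ u v → toℕ u < M → toℕ v < M → toℕ u / ℓ < toℕ v / ℓ → suc M ∸ L ∸ L ≤ mostarTerm u v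
  mostarTerm-legs u v u<M v<M u/ℓ<v/ℓ = ≤-trans (∸-mono many few) (m∸n≤∣m-n∣ (nG G u v) (nG G v u))
    where
    open ≤-Reasoning
    r = toℕ v % ℓ
    closer : ∀ {w} → OffLeg r (toℕ w) → T (dist G w u <ᵇ dist G w v)
    closer (w≤M , w∉leg) = <⇒<ᵇ (closer-to-shallower u v _ u<M v<M u/ℓ<v/ℓ w≤M w∉leg)
    many : suc M ∸ L ≤ nG G u v
    many = begin
      suc M ∸ L                                    ≤⟨ offLeg-count r ⟩
      count (offLeg? r) n                          ≡⟨ length-filter-allFin n (offLeg? r) ⟨
      length (filter (offLeg? r ∘ toℕ) (allFin n)) ≤⟨ length-filter-mono _ (T? ∘ (λ w → dist G w u <ᵇ dist G w v)) closer (allFin n) ⟩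
      nG G u v                                     ∎
    few : nG G v u ≤ L
    few = begin
      nG G v u                                     ≤⟨ length-filter-mono (T? ∘ (λ w → dist G w v <ᵇ dist G w u)) (onLeg? r ∘ toℕ)
                                                        (closer-to-deeper⇒onLeg u v _ u<M v<M u/ℓ<v/ℓ ∘ <ᵇ⇒< _ _) (allFin n) ⟩
      length (filter (onLeg? r ∘ toℕ) (allFin n))  ≡⟨ length-filter-allFin n (onLeg? r) ⟩
      count (onLeg? r) n                           ≤⟨ leg-count r ⟩
      L                                            ∎

  Deeper : ℕ → ℕ → Set
  Deeper a j = a + ℓ ≤ j × j < M

  deeper? : ∀ a → Decidable (Deeper a)
  deeper? a j = (a + ℓ ≤? j) ×-dec (j <? M)

  deeper-count : ∀ a → M ∸ (a + ℓ) ≤ count (deeper? a) n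
  deeper-count a with ≤-total (a + ℓ) M
  ... | inj₁ a+ℓ≤M = ≤-reflexive (sym (count-interval (deeper? a) a+ℓ≤M (<⇒≤ M<n) λ _ _ → mk⇔ id id))
  ... | inj₂ M≤a+ℓ = subst (_≤ count (deeper? a) n) (sym (m≤n⇒m∸n≡0 M≤a+ℓ)) z≤n

  rowSum-legs : ∀ u → (suc M ∸ L ∸ L) * (M ∸ ℓ ∸ toℕ u) ≤ rowSum u
  rowSum-legs u = begin
      gap * (M ∸ ℓ ∸ a)                                  ≡⟨ cong (gap *_) (trans (∸-+-assoc M ℓ a) (cong (M ∸_) (+-comm ℓ a))) ⟩
      gap * (M ∸ (a + ℓ))                                ≤⟨ *-monoʳ-≤ gap (deeper-count a) ⟩
      gap * count (deeper? a) n                          ≡⟨ cong (gap *_) (length-filter-allFin n (deeper? a)) ⟨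
      gap * length (filter (deeper? a ∘ toℕ) (allFin n)) ≤⟨ *length-filter-≤-sum (deeper? a ∘ toℕ) (T? ∘ (λ v → a <ᵇ toℕ v))
                                                              (mostarTerm u) gap later gap≤term (allFin n) ⟩
      rowSum u                                           ∎
    where
    open ≤-Reasoning
    a = toℕ u
    gap = suc M ∸ L ∸ L
    a<a+ℓ = m<m+n a (>-nonZero⁻¹ ℓ)
    later : ∀ {v} → Deeper a (toℕ v) → T (a <ᵇ toℕ v)
    later (a+ℓ≤v , _) = <⇒<ᵇ (<-≤-trans a<a+ℓ a+ℓ≤v)
    gap≤term : ∀ {v} → Deeper a (toℕ v) → gap ≤ mostarTerm u v
    gap≤term {v} (a+ℓ≤v , v<M) = mostarTerm-legs u v (<-≤-trans a<a+ℓ (≤-trans a+ℓ≤v (<⇒≤ v<M))) v<M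
      (<-≤-trans (subst (a / ℓ <_) (sym ([a+ℓ]/ℓ≡1+a/ℓ a)) (n<1+n (a / ℓ))) (/-monoˡ-≤ ℓ a+ℓ≤v))

  2*totalMostar-≥ : (suc M ∸ L ∸ L) * ((M ∸ ℓ) * (M ∸ ℓ)) ≤ 2 * totalMostar G
  2*totalMostar-≥ = c*A²≤2*totalMostar (suc M ∸ L ∸ L) (M ∸ ℓ) (≤-trans (m∸n≤m M ℓ) (<⇒≤ M<n)) rowSum-legs

  CliquePair-sym : ∀ {a b} → CliquePair a b → CliquePair b a
  CliquePair-sym (ca , cb , a≢b) = cb , ca , a≢b ∘ sym

  Edge-fromClique : ∀ {a b} → InClique a → Edge a b → CliquePair a b
  Edge-fromClique (M<a , _) (step (refl , b<M))      = contradiction (≤-<-trans (m≤m+n _ ℓ) b<M) (<-asym M<a)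
  Edge-fromClique (M<a , _) (step⁻ (_ , a<M))        = contradiction a<M (<-asym M<a)
  Edge-fromClique (M<a , _) (spoke (refl , _))       = contradiction M<a (<-irrefl refl)
  Edge-fromClique (M<a , _) (spoke⁻ (_ , _ , a<M))   = contradiction a<M (<-asym M<a)
  Edge-fromClique _         (clique p)               = p

  clique-size : count inClique? n ≡ suc k
  clique-size = begin
      count inClique? n      ≡⟨ count-interval inClique? (<⇒≤ 1+M<M+k+2) fits (λ _ _ → mk⇔ id id) ⟩
      M + k + 2 ∸ suc M      ≡⟨ cong (_∸ suc M) (shuffle M k) ⟩
      suc M + suc k ∸ suc M  ≡⟨ m+n∸m≡n (suc M) (suc k) ⟩
      suc k                  ∎
    where
    open ≡-Reasoning
    shuffle : ∀ M k → M + k + 2 ≡ suc M + suc k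
    shuffle = solve-∀

  cliqueDegree : ∀ {a} → InClique a → count (cliquePair? a) n ≡ k
  cliqueDegree {a} a∈K = suc-injective (begin
      suc (count (cliquePair? a) n)                                    ≡⟨ cong₂ _+_ just-a others ⟨
      count (λ j → inClique? j ×-dec (j ≟ a)) n
        + count (λ j → inClique? j ×-dec ¬? (j ≟ a)) n                 ≡⟨ count-partition inClique? (_≟ a) n ⟨
      count inClique? n                                                ≡⟨ clique-size ⟩
      suc k                                                            ∎)
    where
    open ≡-Reasoning
    just-a : count (λ j → inClique? j ×-dec (j ≟ a)) n ≡ 1
    just-a = ≤-antisym (count-≤1 _ a n λ _ _ → proj₂) (count-pos _ (<-≤-trans (proj₂ a∈K) fits) (a∈K , refl))
    others : count (λ j → inClique? j ×-dec ¬? (j ≟ a)) n ≡ count (cliquePair? a) n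
    others = count-cong _ _ n λ _ _ → mk⇔ (λ (j∈K , j≢a) → a∈K , j∈K , j≢a ∘ sym)
                                          (λ (_ , j∈K , a≢j) → j∈K , a≢j ∘ sym)

  LowerNeighbour : ℕ → ℕ → Set
  LowerNeighbour v w = Edge v w × depth w ≤ depth v

  lowerNeighbour? : ∀ v → Decidable (LowerNeighbour v)
  lowerNeighbour? v w = edge? v w ×-dec (depth w ≤? depth v)

  parent : ℕ → ℕ
  parent v = if does (v <? ℓ) then M else v ∸ ℓ

  lowerNeighbour-unique : ∀ {v w} → ¬ InClique v → LowerNeighbour v w → w ≡ parent v
  lowerNeighbour-unique {v} _ (step (refl , w<M) , dw≤dv) =
    contradiction (subst (_≤ depth v) (depth-step w<M) dw≤dv) (n≮n (depth v))
  lowerNeighbour-unique {w = w} _ (step⁻ (refl , v<M) , _)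
    rewrite dec-false (w + ℓ <? ℓ) (m+n≮n w ℓ) = sym (m+n∸n≡m w ℓ)
  lowerNeighbour-unique _ (spoke (refl , w<ℓ , w<M) , dw≤dM) =
    contradiction (subst₂ _≤_ (depth-leg w<M) (depth-≥M ≤-refl) dw≤dM) λ ()
  lowerNeighbour-unique {v} _ (spoke⁻ (refl , v<ℓ , _) , _)
    rewrite dec-true (v <? ℓ) v<ℓ = refl
  lowerNeighbour-unique v∉K (clique (v∈K , _) , _) = contradiction v∈K v∉K

  lowerNeighbour-count : ∀ v → count (lowerNeighbour? v) n ≤ k
  lowerNeighbour-count v with inClique? v
  ... | yes v∈K = ≤-trans (count-mono _ (cliquePair? v) n λ _ _ → Edge-fromClique v∈K ∘ proj₁)
                          (≤-reflexive (cliqueDegree v∈K))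
  ... | no  v∉K = ≤-trans (count-≤1 _ (parent v) n λ _ _ → lowerNeighbour-unique v∉K) 1≤k

  cliqueSubgraph : Subgraph G
  cliqueSubgraph = record
    { S    = does ∘ inClique? ∘ toℕ
    ; H    = λ u v → does (cliquePair? (toℕ u) (toℕ v))
    ; Hsym = λ u v → does-⇔ (mk⇔ CliquePair-sym CliquePair-sym) (cliquePair? (toℕ u) (toℕ v)) (cliquePair? (toℕ v) (toℕ u))
    ; H⊆G  = λ u v → Equivalence.to T-≡ ∘ adj⁺ {u} {v} ∘ clique
                   ∘ does⇒ (cliquePair? (toℕ u) (toℕ v)) ∘ Equivalence.from T-≡
    ; H⊆S  = λ u v uv∈K → let (u∈K , v∈K , _) = does⇒ (cliquePair? (toℕ u) (toℕ v)) (Equivalence.from T-≡ uv∈K)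
                          in dec-true (inClique? (toℕ u)) u∈K , dec-true (inClique? (toℕ v)) v∈K
    }

  cliqueSubgraph-degree : ∀ v → S cliqueSubgraph v ≡ true → degIn cliqueSubgraph v ≡ k
  cliqueSubgraph-degree v v∈K = trans
    (length-filter-tabulate {n = n} (T? ∘ H cliqueSubgraph v) id (cliquePair? (toℕ v)) λ w →
       mk⇔ (does⇒ (cliquePair? (toℕ v) (toℕ w))) (⇒does (cliquePair? (toℕ v) (toℕ w))))
    (cliqueDegree (does⇒ (inClique? _) (Equivalence.from T-≡ v∈K)))

  hasDegeneracy : HasDegeneracy G k
  hasDegeneracy = lowDegree-fromRanking k (depth ∘ toℕ) few-lower , too-dense
    where
    open Degeneracy G
    few-lower : ∀ v → length (lowerNeighbours (depth ∘ toℕ) v) ≤ k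
    few-lower v = ≤-trans
      (≤-reflexive (length-filter-tabulate {n = n} _ id (lowerNeighbour? (toℕ v)) λ _ →
                      mk⇔ (λ (e , d) → adj⁻ e , d) (λ (e , d) → adj⁺ e , d)))
      (lowerNeighbour-count (toℕ v))
    first-clique-vertex = fromℕ< 1+M<n
    too-dense : ∀ j → j < k → ¬ EverySubgraphHasLowDeg G j
    too-dense j j<k = ¬lowDegree-fromSubgraph j cliqueSubgraph
      (first-clique-vertex , dec-true (inClique? _) (subst InClique (sym (toℕ-fromℕ< 1+M<n)) (≤-refl , 1+M<M+k+2)))
      λ v v∈K → subst (j <_) (sym (cliqueSubgraph-degree v v∈K)) j<k

cube-deficit : ∀ {n x y a b} → x ≤ n → y ≤ n → n ≤ x + a → n ≤ y + b →
               n * (n * n) ≤ x * (y * y) + n * n * (a + 2 * b)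
cube-deficit {n} {x} {y} {a} {b} x≤n y≤n n≤x+a n≤y+b = begin
    n * (n * n)                                                     ≡⟨ cong (_* (n * n)) x+p≡n ⟨
    (x + p) * (n * n)                                               ≡⟨ cong (λ z → (x + p) * (z * z)) y+q≡n ⟨
    (x + p) * ((y + q) * (y + q))                                   ≡⟨ expand x p y q ⟩
    x * (y * y) + x * (q * (y + (y + q))) + p * ((y + q) * (y + q)) ≡⟨ cong (λ z → x * (y * y) + x * (q * (y + z)) + p * (z * z)) y+q≡n ⟩
    x * (y * y) + x * (q * (y + n)) + p * (n * n)                   ≤⟨ +-mono-≤ (+-monoʳ-≤ (x * (y * y)) (*-mono-≤ x≤n (*-mono-≤ q≤b (+-monoˡ-≤ n y≤n))))
                                                                                (*-monoˡ-≤ (n * n) p≤a) ⟩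
    x * (y * y) + n * (b * (n + n)) + a * (n * n)                   ≡⟨ collect (x * (y * y)) n a b ⟩
    x * (y * y) + n * n * (a + 2 * b)                               ∎
  where
  open ≤-Reasoning
  p = n ∸ x
  q = n ∸ y
  x+p≡n : x + p ≡ n
  x+p≡n = m+[n∸m]≡n x≤n
  y+q≡n : y + q ≡ n
  y+q≡n = m+[n∸m]≡n y≤n
  p≤a : p ≤ a
  p≤a = subst (p ≤_) (m+n∸m≡n x a) (∸-monoˡ-≤ x n≤x+a)
  q≤b : q ≤ b
  q≤b = subst (q ≤_) (m+n∸m≡n y b) (∸-monoˡ-≤ y n≤y+b)
  expand : ∀ x p y q → (x + p) * ((y + q) * (y + q)) ≡ x * (y * y) + x * (q * (y + (y + q))) + p * ((y + q) * (y + q))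
  expand = solve-∀
  collect : ∀ X n a b → X + n * (b * (n + n)) + a * (n * n) ≡ X + n * n * (a + 2 * b)
  collect = solve-∀

m*n³≤m*xy²+n³ : ∀ {m n x y a b} → x ≤ n → y ≤ n → n ≤ x + a → n ≤ y + b → m * (a + 2 * b) ≤ n →
                m * n ^ 3 ≤ m * (x * (y * y)) + n ^ 3
m*n³≤m*xy²+n³ {m} {n} {x} {y} {a} {b} x≤n y≤n n≤x+a n≤y+b m[a+2b]≤n = begin
    m * n ^ 3                                                 ≡⟨ cong (m *_) (n^3≡ n) ⟩
    m * (n * (n * n))                                         ≤⟨ *-monoʳ-≤ m (cube-deficit x≤n y≤n n≤x+a n≤y+b) ⟩
    m * (x * (y * y) + n * n * (a + 2 * b))                   ≡⟨ distribute m (x * (y * y)) (n * n) (a + 2 * b) ⟩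
    m * (x * (y * y)) + n * n * (m * (a + 2 * b))             ≤⟨ +-monoʳ-≤ (m * (x * (y * y))) (*-monoʳ-≤ (n * n) m[a+2b]≤n) ⟩
    m * (x * (y * y)) + n * n * n                             ≡⟨ cong (m * (x * (y * y)) +_) (trans (*-assoc n n n) (sym (n^3≡ n))) ⟩
    m * (x * (y * y)) + n ^ 3                                 ∎
  where
  open ≤-Reasoning
  n^3≡ : ∀ n → n ^ 3 ≡ n * (n * n)
  n^3≡ n = cong (λ z → n * (n * z)) (*-identityʳ n)
  distribute : ∀ m X N c → m * (X + N * c) ≡ m * X + N * (m * c)
  distribute = solve-∀

-- with ℓ = 12m + 1 legs of length ⌊(n − k − 2) / ℓ⌋, only O(m + k) vertices lie off the legs
-- and a single leg holds a 1/ℓ fraction of the rest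
module SpiderParameters (m n k : ℕ) (1≤m : 1 ≤ m) (1≤k : 1 ≤ k) (18mk≤n : 18 * m * k ≤ n) (213m²≤n : 213 * (m * m) ≤ n)
  where

  ℓ L M X : ℕ
  ℓ = suc (12 * m)
  L = (n ∸ (k + 2)) / ℓ
  M = L * ℓ
  X = ℓ + (k + 2)

  k+2≤n : k + 2 ≤ n
  k+2≤n = begin
    k + 2        ≤⟨ +-monoʳ-≤ k (*-monoʳ-≤ 2 1≤k) ⟩
    k + 2 * k    ≡⟨⟩
    3 * k        ≤⟨ *-monoˡ-≤ k (≤-trans (m≤m+n 3 15) (*-monoʳ-≤ 18 1≤m)) ⟩
    18 * m * k   ≤⟨ 18mk≤n ⟩
    n            ∎
    where open ≤-Reasoning

  fits : M + k + 2 ≤ n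
  fits = subst (_≤ n) (sym (+-assoc M k 2))
    (subst (M + (k + 2) ≤_) (m∸n+n≡m k+2≤n) (+-monoˡ-≤ (k + 2) (m/n*n≤m (n ∸ (k + 2)) ℓ)))

  open SpiderWithClique n k ℓ L 1≤k (s≤s (≤-trans (s≤s z≤n) (*-monoʳ-≤ 12 1≤m))) fits public
    using (G; hasDegeneracy; 2*totalMostar-≥; M<n)

  n≤M+X : n ≤ M + X
  n≤M+X = begin
    n                         ≡⟨ m∸n+n≡m k+2≤n ⟨
    t + (k + 2)               ≡⟨ cong (_+ (k + 2)) (m≡m%n+[m/n]*n t ℓ) ⟩
    t % ℓ + M + (k + 2)       ≤⟨ +-monoˡ-≤ (k + 2) (+-monoˡ-≤ M (<⇒≤ (m%n<n t ℓ))) ⟩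
    ℓ + M + (k + 2)           ≡⟨ cong (_+ (k + 2)) (+-comm ℓ M) ⟩
    M + ℓ + (k + 2)           ≡⟨ +-assoc M ℓ (k + 2) ⟩
    M + X                     ∎
    where
    open ≤-Reasoning
    t = n ∸ (k + 2)

  n≤[1+M∸L∸L]+[L+L+X] : n ≤ (suc M ∸ L ∸ L) + (L + L + X)
  n≤[1+M∸L∸L]+[L+L+X] = begin
    n                             ≤⟨ n≤M+X ⟩
    M + X                         ≤⟨ +-monoˡ-≤ X (≤-trans (n≤1+n M) (m≤n+m∸n (suc M) (L + L))) ⟩
    L + L + (suc M ∸ (L + L)) + X ≡⟨ cong (λ z → L + L + z + X) (∸-+-assoc (suc M) L L) ⟨
    L + L + D + X                 ≡⟨ cong (_+ X) (+-comm (L + L) D) ⟩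
    D + (L + L) + X               ≡⟨ +-assoc D (L + L) X ⟩
    D + (L + L + X)               ∎
    where
    open ≤-Reasoning
    D = suc M ∸ L ∸ L

  n≤[M∸ℓ]+[ℓ+X] : n ≤ (M ∸ ℓ) + (ℓ + X)
  n≤[M∸ℓ]+[ℓ+X] = begin
    n                         ≤⟨ n≤M+X ⟩
    M + X                     ≤⟨ +-monoˡ-≤ X (m≤n+m∸n M ℓ) ⟩
    ℓ + (M ∸ ℓ) + X           ≡⟨ cong (_+ X) (+-comm ℓ (M ∸ ℓ)) ⟩
    (M ∸ ℓ) + ℓ + X           ≡⟨ +-assoc (M ∸ ℓ) ℓ X ⟩
    (M ∸ ℓ) + (ℓ + X)         ∎
    where open ≤-Reasoning

  m*[a+2b]≤n : m * ((L + L + X) + 2 * (ℓ + X)) ≤ n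
  m*[a+2b]≤n = *-cancelˡ-≤ 6 (begin
    6 * (m * ((L + L + X) + 2 * (ℓ + X)))                    ≡⟨ expand m L k ⟩
    12 * m * L + 2 * (180 * (m * m) + 33 * m) + 18 * m * k   ≤⟨ +-mono-≤ (+-mono-≤ 12mL≤n (*-monoʳ-≤ 2 quadratic≤n)) 18mk≤n ⟩
    n + 2 * n + n                                            ≡⟨ four n ⟩
    4 * n                                                    ≤⟨ *-monoˡ-≤ n (m≤m+n 4 2) ⟩
    6 * n                                                    ∎)
    where
    open ≤-Reasoning
    expand : ∀ m L k → 6 * (m * (L + L + (suc (12 * m) + (k + 2)) + 2 * (suc (12 * m) + (suc (12 * m) + (k + 2)))))
                     ≡ 12 * m * L + 2 * (180 * (m * m) + 33 * m) + 18 * m * k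
    expand = solve-∀
    four : ∀ n → n + 2 * n + n ≡ 4 * n
    four = solve-∀
    spread : ∀ m L → 12 * m * L + L ≡ L * suc (12 * m)
    spread = solve-∀
    combine : ∀ m → 180 * (m * m) + 33 * (m * m) ≡ 213 * (m * m)
    combine = solve-∀
    12mL≤n : 12 * m * L ≤ n
    12mL≤n = ≤-trans (≤-trans (m≤m+n (12 * m * L) L) (≤-reflexive (spread m L))) (<⇒≤ M<n)
    m≤m*m : m ≤ m * m
    m≤m*m = subst (_≤ m * m) (*-identityʳ m) (*-monoʳ-≤ m 1≤m)
    quadratic≤n : 180 * (m * m) + 33 * m ≤ n
    quadratic≤n = ≤-trans (+-monoʳ-≤ (180 * (m * m)) (*-monoʳ-≤ 33 m≤m*m)) (≤-trans (≤-reflexive (combine m)) 213m²≤n)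

  highMostar : m * n ^ 3 ≤ 2 * m * totalMostar G + n ^ 3
  highMostar = begin
    m * n ^ 3                                 ≤⟨ m*n³≤m*xy²+n³ {m} D≤n A≤n n≤[1+M∸L∸L]+[L+L+X] n≤[M∸ℓ]+[ℓ+X] m*[a+2b]≤n ⟩
    m * (D * ((M ∸ ℓ) * (M ∸ ℓ))) + n ^ 3     ≤⟨ +-monoˡ-≤ (n ^ 3) (*-monoʳ-≤ m 2*totalMostar-≥) ⟩
    m * (2 * totalMostar G) + n ^ 3           ≡⟨ cong (_+ n ^ 3) (sym (*-assoc m 2 _)) ⟩
    m * 2 * totalMostar G + n ^ 3             ≡⟨ cong (λ z → z * totalMostar G + n ^ 3) (*-comm m 2) ⟩
    2 * m * totalMostar G + n ^ 3             ∎
    where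
    open ≤-Reasoning
    D = suc M ∸ L ∸ L
    D≤n : D ≤ n
    D≤n = ≤-trans (m∸n≤m (suc M ∸ L) L) (≤-trans (m∸n≤m (suc M) L) M<n)
    A≤n : M ∸ ℓ ≤ n
    A≤n = ≤-trans (m∸n≤m M ℓ) (<⇒≤ M<n)

highMostar-withDegeneracy : ∀ m n k → 1 ≤ m → 1 ≤ k → 18 * m * k ≤ n → 213 * (m * m) ≤ n →
                            Σ (Graph n) λ G → HasDegeneracy G k × m * n ^ 3 ≤ 2 * m * totalMostar G + n ^ 3
highMostar-withDegeneracy m n k 1≤m 1≤k 18mk≤n 213m²≤n = G , hasDegeneracy , highMostar
  where open SpiderParameters m n k 1≤m 1≤k 18mk≤n 213m²≤n

x≤x^2 : ∀ x → x ≤ x ^ 2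
x≤x^2 zero    = z≤n
x≤x^2 (suc x) = subst (suc x ≤_) (cong (suc x *_) (sym (*-identityʳ (suc x)))) (m≤m*n (suc x) (suc x))

mainTheorem11 :
    (k : ℕ → ℕ) →
    (∀ n → 1 ≤ k n) →
    (∀ m → 1 ≤ m → ∃ λ N → ∀ n → N ≤ n → (m * k n) ^ 2 ≤ n) →
    ∀ m → 1 ≤ m → ∃ λ N → ∀ n → N ≤ n →
      ((G : Graph n) → HasDegeneracy G (k n) →
          2 * m * totalMostar G ≤ (m + 1) * n ^ 3)
      × (Σ (Graph n) λ G → HasDegeneracy G (k n) ×
          m * n ^ 3 ≤ 2 * m * totalMostar G + n ^ 3)
mainTheorem11 k 1≤k k²-small m 1≤m with k²-small (18 * m) (≤-trans 1≤m (m≤n*m m 18))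
... | N , 18mk-small = N ⊔ 213 * (m * m) , λ n N≤n → upper n , lower n N≤n
  where
  upper : ∀ n (G : Graph n) → HasDegeneracy G (k n) → 2 * m * totalMostar G ≤ (m + 1) * n ^ 3
  upper n G _ = begin
    2 * m * totalMostar G    ≡⟨ cong (_* totalMostar G) (*-comm 2 m) ⟩
    m * 2 * totalMostar G    ≡⟨ *-assoc m 2 (totalMostar G) ⟩
    m * (2 * totalMostar G)  ≤⟨ *-monoʳ-≤ m (MostarSums.2*totalMostar≤n^3 G) ⟩
    m * n ^ 3                ≤⟨ *-monoˡ-≤ (n ^ 3) (m≤m+n m 1) ⟩
    (m + 1) * n ^ 3          ∎
    where open ≤-Reasoning
  lower : ∀ n → N ⊔ 213 * (m * m) ≤ n →
          Σ (Graph n) λ G → HasDegeneracy G (k n) × m * n ^ 3 ≤ 2 * m * totalMostar G + n ^ 3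
  lower n N≤n = highMostar-withDegeneracy m n (k n) 1≤m (1≤k n)
    (≤-trans (x≤x^2 (18 * m * k n)) (18mk-small n (≤-trans (m≤m⊔n N _) N≤n)))
    (≤-trans (m≤n⊔m N _) N≤n)
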